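{- Let $G$ be a short game all of whose options are numbers, such that both $L(G)\neq\emptyset$ and $R(G)\neq\emptyset$. Then $G\triangleq\{a\mid b\}$ for some numbers $a$ and $b$ in canonical form.
   Context: Games are short normal-play combinatorial games $G\cong\{L(G)\mid R(G)\}$ with the usual disjunctive sum, negation, order and equality. A game is a number if all its options are numbers and every Left option is strictly less than every Right option; values of short numbers are dyadic rationals and each has a unique canonical form. $G\triangleq H$ (equivalence modulo domination) means that in $G+(-H)$, for every first move by either player in either summand, the other player has a winning response made in the other summand. -}

module Defs where

open import Data.List using (List; []; _∷_; _++_; length; lookup)
open import Data.List.Membership.Propositional using (_∈_)
open import Data.Product using (_×_; Σ; ∃; _,_)
open import Data.Unit using (⊤)
open import Data.Fin using (Fin)
open import Relation.Nullary using (¬_)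
open import Relation.Binary.PropositionalEquality using (_≢_)

data Game : Set where
  ⟨_∣_⟩ : List Game → List Game → Game

L : Game → List Game
L ⟨ l ∣ r ⟩ = l

R : Game → List Game
R ⟨ l ∣ r ⟩ = r

0G : Game
0G = ⟨ [] ∣ [] ⟩

mutual
  -_ : Game → Game
  - ⟨ l ∣ r ⟩ = ⟨ negs r ∣ negs l ⟩

  negs : List Game → List Game
  negs [] = []
  negs (x ∷ xs) = (- x) ∷ negs xs

mutual
  _+_ : Game → Game → Game
  G@(⟨ gl ∣ gr ⟩) + H@(⟨ hl ∣ hr ⟩) =
    ⟨ addˡ gl H ++ addʳ G hl ∣ addˡ gr H ++ addʳ G hr ⟩

  addˡ : List Game → Game → List Game
  addˡ [] H = []
  addˡ (x ∷ xs) H = (x + H) ∷ addˡ xs H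

  addʳ : Game → List Game → List Game
  addʳ G [] = []
  addʳ G (x ∷ xs) = (G + x) ∷ addʳ G xs

infixl 6 _+_
infix 8 -_

mutual
  _≤_ : Game → Game → Set
  G@(⟨ gl ∣ gr ⟩) ≤ H@(⟨ hl ∣ hr ⟩) = NoneAbove H gl × NoneBelow G hr

  NoneAbove : Game → List Game → Set
  NoneAbove H [] = ⊤
  NoneAbove H (x ∷ xs) = ¬ (H ≤ x) × NoneAbove H xs

  NoneBelow : Game → List Game → Set
  NoneBelow G [] = ⊤
  NoneBelow G (y ∷ ys) = ¬ (y ≤ G) × NoneBelow G ys

infix 4 _≤_ _<_

_<_ : Game → Game → Set
G < H = G ≤ H × ¬ (H ≤ G)

mutual
  IsNumber : Game → Set
  IsNumber ⟨ l ∣ r ⟩ =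
    AllNumbers l × AllNumbers r × (∀ {x y} → x ∈ l → y ∈ r → x < y)

  AllNumbers : List Game → Set
  AllNumbers [] = ⊤
  AllNumbers (x ∷ xs) = IsNumber x × AllNumbers xs

NoDominated : List Game → Set
NoDominated xs = (i j : Fin (length xs)) → i ≢ j → ¬ (lookup xs i ≤ lookup xs j)

NoReversible : Game → Set
NoReversible G =
  (∀ {x y} → x ∈ L G → y ∈ R x → ¬ (y ≤ G)) ×
  (∀ {x y} → x ∈ R G → y ∈ L x → ¬ (G ≤ y))

mutual
  IsCanonical : Game → Set
  IsCanonical G@(⟨ l ∣ r ⟩) =
    AllCanonical l × AllCanonical r × NoDominated l × NoDominated r × NoReversible G

  AllCanonical : List Game → Set
  AllCanonical [] = ⊤
  AllCanonical (x ∷ xs) = IsCanonical x × AllCanonical xs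

-- G ≜ H: in G + (-H), for every first move by either player in either
-- summand, the other player has a winning response in the other summand.
-- After the response the first mover is to move; Right wins such a position X
-- iff X ≤ 0, Left wins it iff 0 ≤ X.
_≜_ : Game → Game → Set
G ≜ H =
  (∀ {x} → x ∈ L G → ∃ λ k → k ∈ R (- H) × (x + k ≤ 0G)) ×
  (∀ {x} → x ∈ R G → ∃ λ k → k ∈ L (- H) × (0G ≤ x + k)) ×
  (∀ {k} → k ∈ L (- H) → ∃ λ x → x ∈ R G × (x + k ≤ 0G)) ×
  (∀ {k} → k ∈ R (- H) → ∃ λ x → x ∈ L G × (0G ≤ x + k))

infix 4 _≜_

{-# OPTIONS --safe #-}
module Submission where

open import Defs
open import Data.Fin using (zero; suc)
open import Data.List using (List; []; _∷_; _++_)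
open import Data.List.Membership.Propositional using (_∈_; find; lose)
open import Data.List.Relation.Unary.Any using (here; there; any?)
open import Data.Product using (_×_; _,_; proj₁; proj₂; ∃-syntax; ∃₂)
open import Data.Product.Function.NonDependent.Propositional using (_×-⇔_)
open import Data.Sum using (_⊎_; inj₁; inj₂)
open import Data.Unit using (tt)
open import Function.Bundles using (_⇔_; mk⇔; Equivalence)
open import Function.Construct.Composition using (_⇔-∘_)
open import Function.Related.TypeIsomorphisms using (¬-cong-⇔)
open import Induction.WellFounded using (WellFounded; Acc; acc)
open import Relation.Binary.PropositionalEquality using (_≢_; refl)
open import Relation.Nullary using (¬_; Dec; yes; no; contradiction)
open import Relation.Nullary.Decidable using (¬?; _×-dec_)

open Equivalence using (to; from)

-- The greatest Left option and the least Right option of G are numbers, equal to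
-- canonical numbers a and b.  Every Left option of G is at most a, so Right answers
-- it with -a in G - {a | b}, while Left's only move -b there is answered by the
-- least Right option of G; the other two first moves are symmetric.  A number has
-- a canonical form by induction: keeping only its greatest Left and least Right
-- option, each replaced by its canonical form, does not change its value, and
-- bypassing reversible options from there ends in canonical form.

-- The order on games

NoneAbove⁺ : ∀ {H} xs → (∀ {x} → x ∈ xs → ¬ H ≤ x) → NoneAbove H xs
NoneAbove⁺ []       f = tt
NoneAbove⁺ (x ∷ xs) f = f (here refl) , NoneAbove⁺ xs (λ p → f (there p))

NoneAbove⁻ : ∀ {H x xs} → NoneAbove H xs → x ∈ xs → ¬ H ≤ x
NoneAbove⁻ (H≰x , _) (here refl) = H≰x
NoneAbove⁻ (_ , rest) (there p)  = NoneAbove⁻ rest p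

NoneBelow⁺ : ∀ {G} ys → (∀ {y} → y ∈ ys → ¬ y ≤ G) → NoneBelow G ys
NoneBelow⁺ []       f = tt
NoneBelow⁺ (y ∷ ys) f = f (here refl) , NoneBelow⁺ ys (λ p → f (there p))

NoneBelow⁻ : ∀ {G y ys} → NoneBelow G ys → y ∈ ys → ¬ y ≤ G
NoneBelow⁻ (y≰G , _) (here refl) = y≰G
NoneBelow⁻ (_ , rest) (there p)  = NoneBelow⁻ rest p

≤-intro : ∀ {G H} → (∀ {x} → x ∈ L G → ¬ H ≤ x) → (∀ {y} → y ∈ R H → ¬ y ≤ G) → G ≤ H
≤-intro {⟨ gl ∣ _ ⟩} {⟨ _ ∣ hr ⟩} above below = NoneAbove⁺ gl above , NoneBelow⁺ hr below

≤-elimˡ : ∀ {G H x} → G ≤ H → x ∈ L G → ¬ H ≤ x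
≤-elimˡ {⟨ _ ∣ _ ⟩} {⟨ _ ∣ _ ⟩} (above , _) = NoneAbove⁻ above

≤-elimʳ : ∀ {G H y} → G ≤ H → y ∈ R H → ¬ y ≤ G
≤-elimʳ {⟨ _ ∣ _ ⟩} {⟨ _ ∣ _ ⟩} (_ , below) = NoneBelow⁻ below

mutual
  _≤?_ : ∀ G H → Dec (G ≤ H)
  G@(⟨ gl ∣ _ ⟩) ≤? H@(⟨ _ ∣ hr ⟩) = NoneAbove? H gl ×-dec NoneBelow? G hr

  NoneAbove? : ∀ H xs → Dec (NoneAbove H xs)
  NoneAbove? H []       = yes tt
  NoneAbove? H (x ∷ xs) = ¬? (H ≤? x) ×-dec NoneAbove? H xs

  NoneBelow? : ∀ G ys → Dec (NoneBelow G ys)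
  NoneBelow? G []       = yes tt
  NoneBelow? G (y ∷ ys) = ¬? (y ≤? G) ×-dec NoneBelow? G ys

mutual
  ≤-trans : ∀ {G H K} → G ≤ H → H ≤ K → G ≤ K
  ≤-trans {⟨ gl ∣ _ ⟩} {⟨ _ ∣ _ ⟩} {⟨ _ ∣ kr ⟩} G≤H@(H-above , _) H≤K@(_ , K-below) =
    NoneAbove-trans gl H-above H≤K , NoneBelow-trans kr G≤H K-below

  NoneAbove-trans : ∀ {H K} xs → NoneAbove H xs → H ≤ K → NoneAbove K xs
  NoneAbove-trans []       _            _   = tt
  NoneAbove-trans (x ∷ xs) (H≰x , rest) H≤K =
    (λ K≤x → H≰x (≤-trans H≤K K≤x)) , NoneAbove-trans xs rest H≤K

  NoneBelow-trans : ∀ {G H} ys → G ≤ H → NoneBelow H ys → NoneBelow G ys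
  NoneBelow-trans []       _   _            = tt
  NoneBelow-trans (y ∷ ys) G≤H (y≰H , rest) =
    (λ y≤G → y≰H (≤-trans y≤G G≤H)) , NoneBelow-trans ys G≤H rest

data _⊏_ : Game → Game → Set where
  leftOption  : ∀ {x G} → x ∈ L G → x ⊏ G
  rightOption : ∀ {x G} → x ∈ R G → x ⊏ G

mutual
  ⊏-wellFounded : WellFounded _⊏_
  ⊏-wellFounded ⟨ l ∣ r ⟩ = acc λ where
    (leftOption p)  → ∈⇒Acc l p
    (rightOption p) → ∈⇒Acc r p

  ∈⇒Acc : ∀ xs {x} → x ∈ xs → Acc _⊏_ x
  ∈⇒Acc (x ∷ _)  (here refl) = ⊏-wellFounded x
  ∈⇒Acc (_ ∷ xs) (there p)   = ∈⇒Acc xs p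

≤-refl′ : ∀ {G} → Acc _⊏_ G → G ≤ G
≤-refl′ (acc rs) = ≤-intro
  (λ p G≤x → ≤-elimˡ G≤x p (≤-refl′ (rs (leftOption p))))
  (λ p y≤G → ≤-elimʳ y≤G p (≤-refl′ (rs (rightOption p))))

≤-refl : ∀ G → G ≤ G
≤-refl G = ≤-refl′ (⊏-wellFounded G)

≰-leftOption : ∀ {G x} → x ∈ L G → ¬ G ≤ x
≰-leftOption {x = x} p G≤x = ≤-elimˡ G≤x p (≤-refl x)

≰-rightOption : ∀ {G y} → y ∈ R G → ¬ y ≤ G
≰-rightOption {y = y} p y≤G = ≤-elimʳ y≤G p (≤-refl y)

≰-witness : ∀ {G H} → ¬ G ≤ H → (∃[ x ] x ∈ L G × H ≤ x) ⊎ (∃[ y ] y ∈ R H × y ≤ G)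
≰-witness {G} {H} G≰H with any? (H ≤?_) (L G) | any? (_≤? G) (R H)
... | yes above | _        = inj₁ (find above)
... | no _      | yes below = inj₂ (find below)
... | no ¬above | no ¬below =
  contradiction (≤-intro (λ p H≤x → ¬above (lose p H≤x)) (λ p y≤G → ¬below (lose p y≤G))) G≰H

_≼_ : List Game → List Game → Set
xs ≼ ys = ∀ {x} → x ∈ xs → ∃[ y ] y ∈ ys × x ≤ y

_≽_ : List Game → List Game → Set
xs ≽ ys = ∀ {x} → x ∈ xs → ∃[ y ] y ∈ ys × y ≤ x

≤-cofinal : ∀ {G H} → L G ≼ L H → R H ≽ R G → G ≤ H
≤-cofinal {G} {H} left right = ≤-intro
  (λ p H≤x → let (y , q , x≤y) = left p in ≰-leftOption q (≤-trans H≤x x≤y))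
  (λ p y≤G → let (x , q , x≤y) = right p in ≰-rightOption q (≤-trans x≤y y≤G))

_≈_ : Game → Game → Set
G ≈ H = G ≤ H × H ≤ G

≈-refl : ∀ {G} → G ≈ G
≈-refl {G} = ≤-refl G , ≤-refl G

≈-trans : ∀ {G H K} → G ≈ H → H ≈ K → G ≈ K
≈-trans (G≤H , H≤G) (H≤K , K≤H) = ≤-trans G≤H H≤K , ≤-trans K≤H H≤G

-- Differences

NoneAbove-++ : ∀ {H} xs ys → NoneAbove H (xs ++ ys) ⇔ (NoneAbove H xs × NoneAbove H ys)
NoneAbove-++ []       ys = mk⇔ (tt ,_) proj₂
NoneAbove-++ (x ∷ xs) ys = mk⇔
  (λ (H≰x , rest) → let (rest₁ , rest₂) = to (NoneAbove-++ xs ys) rest in (H≰x , rest₁) , rest₂)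
  (λ ((H≰x , rest₁) , rest₂) → H≰x , from (NoneAbove-++ xs ys) (rest₁ , rest₂))

NoneBelow-++ : ∀ {G} xs ys → NoneBelow G (xs ++ ys) ⇔ (NoneBelow G xs × NoneBelow G ys)
NoneBelow-++ []       ys = mk⇔ (tt ,_) proj₂
NoneBelow-++ (x ∷ xs) ys = mk⇔
  (λ (x≰G , rest) → let (rest₁ , rest₂) = to (NoneBelow-++ xs ys) rest in (x≰G , rest₁) , rest₂)
  (λ ((x≰G , rest₁) , rest₂) → x≰G , from (NoneBelow-++ xs ys) (rest₁ , rest₂))

mutual
  x-y≤0⇔x≤y : ∀ x y → x + - y ≤ 0G ⇔ x ≤ y
  x-y≤0⇔x≤y x@(⟨ xl ∣ _ ⟩) y@(⟨ _ ∣ yr ⟩) =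
    let options = (NoneAbove-addˡ xl y ×-⇔ NoneAbove-addʳ x yr) ⇔-∘ NoneAbove-++ _ _
    in mk⇔ (λ (h , _) → to options h) (λ h → from options h , tt)

  0≤x-y⇔y≤x : ∀ x y → 0G ≤ x + - y ⇔ y ≤ x
  0≤x-y⇔y≤x x@(⟨ _ ∣ xr ⟩) y@(⟨ yl ∣ _ ⟩) =
    let options = (NoneBelow-addˡ xr y ×-⇔ NoneBelow-addʳ x yl) ⇔-∘ NoneBelow-++ _ _
    in mk⇔ (λ (_ , h) → let (r , l) = to options h in l , r)
           (λ (l , r) → tt , from options (r , l))

  NoneAbove-addˡ : ∀ xs y → NoneAbove 0G (addˡ xs (- y)) ⇔ NoneAbove y xs
  NoneAbove-addˡ []       y = mk⇔ _ _
  NoneAbove-addˡ (x ∷ xs) y = ¬-cong-⇔ (0≤x-y⇔y≤x x y) ×-⇔ NoneAbove-addˡ xs y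

  NoneAbove-addʳ : ∀ x ys → NoneAbove 0G (addʳ x (negs ys)) ⇔ NoneBelow x ys
  NoneAbove-addʳ x []       = mk⇔ _ _
  NoneAbove-addʳ x (y ∷ ys) = ¬-cong-⇔ (0≤x-y⇔y≤x x y) ×-⇔ NoneAbove-addʳ x ys

  NoneBelow-addˡ : ∀ xs y → NoneBelow 0G (addˡ xs (- y)) ⇔ NoneBelow y xs
  NoneBelow-addˡ []       y = mk⇔ _ _
  NoneBelow-addˡ (x ∷ xs) y = ¬-cong-⇔ (x-y≤0⇔x≤y x y) ×-⇔ NoneBelow-addˡ xs y

  NoneBelow-addʳ : ∀ x ys → NoneBelow 0G (addʳ x (negs ys)) ⇔ NoneAbove x ys
  NoneBelow-addʳ x []       = mk⇔ _ _
  NoneBelow-addʳ x (y ∷ ys) = ¬-cong-⇔ (x-y≤0⇔x≤y x y) ×-⇔ NoneBelow-addʳ x ys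

-- Numbers

AllNumbers-lookup : ∀ {xs x} → AllNumbers xs → x ∈ xs → IsNumber x
AllNumbers-lookup (nx , _)    (here refl) = nx
AllNumbers-lookup (_ , rest) (there p)   = AllNumbers-lookup rest p

leftOptions-numbers : ∀ {x} → IsNumber x → AllNumbers (L x)
leftOptions-numbers {⟨ _ ∣ _ ⟩} (nl , _) = nl

rightOptions-numbers : ∀ {x} → IsNumber x → AllNumbers (R x)
rightOptions-numbers {⟨ _ ∣ _ ⟩} (_ , nr , _) = nr

leftOption<rightOption : ∀ {x z y} → IsNumber x → z ∈ L x → y ∈ R x → z < y
leftOption<rightOption {⟨ _ ∣ _ ⟩} (_ , _ , z<y) = z<y

leftOption≤′ : ∀ {x z} → Acc _⊏_ x → IsNumber x → z ∈ L x → z ≤ x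
leftOption≤′ (acc rs) nx z∈ = ≤-intro
  (λ w∈ x≤w → ≰-leftOption z∈ (≤-trans x≤w (leftOption≤′ (rs (leftOption z∈)) nz w∈)))
  (λ y∈ y≤z → proj₂ (leftOption<rightOption nx z∈ y∈) y≤z)
  where nz = AllNumbers-lookup (leftOptions-numbers nx) z∈

leftOption≤ : ∀ {x z} → IsNumber x → z ∈ L x → z ≤ x
leftOption≤ = leftOption≤′ (⊏-wellFounded _)

≤rightOption′ : ∀ {x y} → Acc _⊏_ x → IsNumber x → y ∈ R x → x ≤ y
≤rightOption′ (acc rs) nx y∈ = ≤-intro
  (λ z∈ y≤z → proj₂ (leftOption<rightOption nx z∈ y∈) y≤z)
  (λ w∈ w≤x → ≰-rightOption y∈ (≤-trans (≤rightOption′ (rs (rightOption y∈)) ny w∈) w≤x))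
  where ny = AllNumbers-lookup (rightOptions-numbers nx) y∈

≤rightOption : ∀ {x y} → IsNumber x → y ∈ R x → x ≤ y
≤rightOption = ≤rightOption′ (⊏-wellFounded _)

IsNumber-intro : ∀ {G} → AllNumbers (L G) → AllNumbers (R G) →
  (∀ {x} → x ∈ L G → x ≤ G) → (∀ {y} → y ∈ R G → G ≤ y) → IsNumber G
IsNumber-intro {⟨ _ ∣ _ ⟩} nl nr below above = nl , nr , λ x∈ y∈ →
  ≤-trans (below x∈) (above y∈) , λ y≤x → ≰-rightOption y∈ (≤-trans y≤x (below x∈))

≤-total : ∀ {x y} → IsNumber x → IsNumber y → x ≤ y ⊎ y ≤ x
≤-total {x} {y} nx ny with x ≤? y
... | yes x≤y = inj₁ x≤y
... | no x≰y with ≰-witness x≰y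
...   | inj₁ (z , z∈ , y≤z) = inj₂ (≤-trans y≤z (leftOption≤ nx z∈))
...   | inj₂ (w , w∈ , w≤x) = inj₂ (≤-trans (≤rightOption ny w∈) w≤x)

maximum : ∀ x xs → AllNumbers (x ∷ xs) → ∃[ m ] m ∈ x ∷ xs × (∀ {z} → z ∈ x ∷ xs → z ≤ m)
maximum x [] _ = x , here refl , λ { (here refl) → ≤-refl x ; (there ()) }
maximum x (y ∷ ys) (nx , nys) with maximum y ys nys
... | m , m∈ , ≤m with ≤-total nx (AllNumbers-lookup nys m∈)
...   | inj₁ x≤m = m , there m∈ , λ { (here refl) → x≤m ; (there z∈) → ≤m z∈ }
...   | inj₂ m≤x = x , here refl , λ { (here refl) → ≤-refl x ; (there z∈) → ≤-trans (≤m z∈) m≤x }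

minimum : ∀ x xs → AllNumbers (x ∷ xs) → ∃[ m ] m ∈ x ∷ xs × (∀ {z} → z ∈ x ∷ xs → m ≤ z)
minimum x [] _ = x , here refl , λ { (here refl) → ≤-refl x ; (there ()) }
minimum x (y ∷ ys) (nx , nys) with minimum y ys nys
... | m , m∈ , m≤ with ≤-total nx (AllNumbers-lookup nys m∈)
...   | inj₂ m≤x = m , there m∈ , λ { (here refl) → m≤x ; (there z∈) → m≤ z∈ }
...   | inj₁ x≤m = x , here refl , λ { (here refl) → ≤-refl x ; (there z∈) → ≤-trans x≤m (m≤ z∈) }

-- Canonical forms of numbers

AllCanonical-lookup : ∀ {xs x} → AllCanonical xs → x ∈ xs → IsCanonical x
AllCanonical-lookup (cx , _)    (here refl) = cx
AllCanonical-lookup (_ , rest) (there p)   = AllCanonical-lookup rest p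

CanonicalForm : Game → Set
CanonicalForm x = ∃[ c ] IsNumber c × IsCanonical c × c ≈ x

data AtMostOne : List Game → Set where
  none : AtMostOne []
  one  : ∀ x → AtMostOne (x ∷ [])

AtMostOne⇒NoDominated : ∀ {xs} → AtMostOne xs → NoDominated xs
AtMostOne⇒NoDominated (one x) zero zero i≢i = contradiction refl i≢i

NoDominated⇒AtMostOne : ∀ xs → AllNumbers xs → NoDominated xs → AtMostOne xs
NoDominated⇒AtMostOne []           _              _ = none
NoDominated⇒AtMostOne (x ∷ [])     _              _ = one x
NoDominated⇒AtMostOne (x ∷ y ∷ _) (nx , ny , _) nd with ≤-total nx ny
... | inj₁ x≤y = contradiction x≤y (nd zero (suc zero) λ ())
... | inj₂ y≤x = contradiction y≤x (nd (suc zero) zero λ ())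

leftOptions-AtMostOne : ∀ {c} → IsNumber c → IsCanonical c → AtMostOne (L c)
leftOptions-AtMostOne {⟨ l ∣ _ ⟩} (nl , _) (_ , _ , ndl , _) = NoDominated⇒AtMostOne l nl ndl

rightOptions-AtMostOne : ∀ {c} → IsNumber c → IsCanonical c → AtMostOne (R c)
rightOptions-AtMostOne {⟨ _ ∣ r ⟩} (_ , nr , _) (_ , _ , _ , ndr , _) = NoDominated⇒AtMostOne r nr ndr

leftOptions-canonical : ∀ {c} → IsCanonical c → AllCanonical (L c)
leftOptions-canonical {⟨ _ ∣ _ ⟩} (cl , _) = cl

rightOptions-canonical : ∀ {c} → IsCanonical c → AllCanonical (R c)
rightOptions-canonical {⟨ _ ∣ _ ⟩} (_ , cr , _) = cr

NoReversibleᴸ : Game → Set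
NoReversibleᴸ G = ∀ {x y} → x ∈ L G → y ∈ R x → ¬ y ≤ G

NoReversibleᴿ : Game → Set
NoReversibleᴿ G = ∀ {x y} → x ∈ R G → y ∈ L x → ¬ G ≤ y

bypassᴸ : ∀ {a r B} → r ∈ R a → r ≤ ⟨ a ∷ [] ∣ B ⟩ → ⟨ L r ∣ B ⟩ ≈ ⟨ a ∷ [] ∣ B ⟩
bypassᴸ {a} {r} {B} r∈ r≤G = G′≤G , G≤G′
  where
  G′ = ⟨ L r ∣ B ⟩
  r≤G′ : r ≤ G′
  r≤G′ = ≤-intro (≰-leftOption {G′}) (λ b∈ b≤r → ≰-rightOption b∈ (≤-trans b≤r r≤G))
  G′≤G = ≤-intro (λ l∈ G≤l → ≰-leftOption l∈ (≤-trans r≤G G≤l)) (≰-rightOption {G′})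
  G≤G′ = ≤-intro (λ { (here refl) G′≤a → ≰-rightOption r∈ (≤-trans r≤G′ G′≤a) ; (there ()) })
                 ≰-rightOption

bypassᴿ : ∀ {A b l} → l ∈ L b → ⟨ A ∣ b ∷ [] ⟩ ≤ l → ⟨ A ∣ R l ⟩ ≈ ⟨ A ∣ b ∷ [] ⟩
bypassᴿ {A} {b} {l} l∈ G≤l = G′≤G , G≤G′
  where
  G′ = ⟨ A ∣ R l ⟩
  G′≤l : G′ ≤ l
  G′≤l = ≤-intro (λ a∈ l≤a → ≰-leftOption a∈ (≤-trans G≤l l≤a)) (≰-rightOption {G′})
  G≤G′ = ≤-intro (≰-leftOption {G′}) (λ r∈ r≤G → ≰-rightOption r∈ (≤-trans r≤G G≤l))
  G′≤G = ≤-intro ≰-leftOption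
                 (λ { (here refl) b≤G′ → ≰-leftOption l∈ (≤-trans b≤G′ G′≤l) ; (there ()) })

LeftReduct : List Game → Game → Set
LeftReduct B G = ∃[ A ] AtMostOne A × AllCanonical A × IsNumber ⟨ A ∣ B ⟩ × ⟨ A ∣ B ⟩ ≈ G × NoReversibleᴸ ⟨ A ∣ B ⟩

RightReduct : List Game → Game → Set
RightReduct A G = ∃[ B ] AtMostOne B × AllCanonical B × IsNumber ⟨ A ∣ B ⟩ × ⟨ A ∣ B ⟩ ≈ G × NoReversibleᴿ ⟨ A ∣ B ⟩

-- Terminates because the replacement of a reversible Left option a is a Left option
-- of a Right option of a.
mutual
  reduceᴸ : ∀ {a B} → Acc _⊏_ a → IsCanonical a → IsNumber ⟨ a ∷ [] ∣ B ⟩ → LeftReduct B ⟨ a ∷ [] ∣ B ⟩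
  reduceᴸ {a} {B} (acc rs) ca nG with any? (_≤? ⟨ a ∷ [] ∣ B ⟩) (R a)
  ... | no irreversible =
    a ∷ [] , one a , (ca , tt) , nG , ≈-refl ,
    λ { (here refl) r∈ r≤G → irreversible (lose r∈ r≤G) ; (there ()) }
  ... | yes reversible =
    let (r , r∈ , r≤G) = find reversible
        ((na , _) , nB , _) = nG
        nr = AllNumbers-lookup (rightOptions-numbers na) r∈
        cr = AllCanonical-lookup (rightOptions-canonical ca) r∈
        (G′≤G , G≤G′) = bypassᴸ r∈ r≤G
        nG′ = IsNumber-intro (leftOptions-numbers nr) nB
                (λ l∈ → ≤-trans (leftOption≤ nr l∈) (≤-trans r≤G G≤G′))
                (λ b∈ → ≤-trans G′≤G (≤rightOption nG b∈))
        (A , A≤1 , cA , nA , A≈G′ , irrA) = reduceᴸ-via (rs (rightOption r∈)) nr cr nG′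
    in A , A≤1 , cA , nA , ≈-trans A≈G′ (G′≤G , G≤G′) , irrA

  reduceᴸ-via : ∀ {r B} → Acc _⊏_ r → IsNumber r → IsCanonical r → IsNumber ⟨ L r ∣ B ⟩ →
    LeftReduct B ⟨ L r ∣ B ⟩
  reduceᴸ-via {⟨ _ ∣ _ ⟩} (acc rs) nr cr nG with leftOptions-AtMostOne nr cr
  ... | none  = [] , none , tt , nG , ≈-refl , λ ()
  ... | one c = reduceᴸ (rs (leftOption (here refl))) (proj₁ (leftOptions-canonical cr)) nG

mutual
  reduceᴿ : ∀ {A b} → Acc _⊏_ b → IsCanonical b → IsNumber ⟨ A ∣ b ∷ [] ⟩ → RightReduct A ⟨ A ∣ b ∷ [] ⟩
  reduceᴿ {A} {b} (acc rs) cb nG with any? (⟨ A ∣ b ∷ [] ⟩ ≤?_) (L b)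
  ... | no irreversible =
    b ∷ [] , one b , (cb , tt) , nG , ≈-refl ,
    λ { (here refl) l∈ G≤l → irreversible (lose l∈ G≤l) ; (there ()) }
  ... | yes reversible =
    let (l , l∈ , G≤l) = find reversible
        (nA , (nb , _) , _) = nG
        nl = AllNumbers-lookup (leftOptions-numbers nb) l∈
        cl = AllCanonical-lookup (leftOptions-canonical cb) l∈
        (G′≤G , G≤G′) = bypassᴿ l∈ G≤l
        nG′ = IsNumber-intro nA (rightOptions-numbers nl)
                (λ a∈ → ≤-trans (leftOption≤ nG a∈) G≤G′)
                (λ r∈ → ≤-trans (≤-trans G′≤G G≤l) (≤rightOption nl r∈))
        (B , B≤1 , cB , nB , B≈G′ , irrB) = reduceᴿ-via (rs (leftOption l∈)) nl cl nG′
    in B , B≤1 , cB , nB , ≈-trans B≈G′ (G′≤G , G≤G′) , irrB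

  reduceᴿ-via : ∀ {l A} → Acc _⊏_ l → IsNumber l → IsCanonical l → IsNumber ⟨ A ∣ R l ⟩ →
    RightReduct A ⟨ A ∣ R l ⟩
  reduceᴿ-via {⟨ _ ∣ _ ⟩} (acc rs) nl cl nG with rightOptions-AtMostOne nl cl
  ... | none  = [] , none , tt , nG , ≈-refl , λ ()
  ... | one c = reduceᴿ (rs (rightOption (here refl))) (proj₁ (rightOptions-canonical cl)) nG

-- Whether a Left option is reversible depends only on the value of the game, so
-- reducing the Right options afterwards keeps the Left options irreversible.
reduce : ∀ {A B} → AtMostOne A → AllCanonical A → AtMostOne B → AllCanonical B →
  IsNumber ⟨ A ∣ B ⟩ → CanonicalForm ⟨ A ∣ B ⟩
reduce {A} {B} A≤1 cA B≤1 cB nG =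
  let (A′ , A′≤1 , cA′ , nG′ , G′≈G , irrA′) = reduceLeft A≤1 cA nG
      (B′ , B′≤1 , cB′ , nG″ , (G″≤G′ , G′≤G″) , irrB′) = reduceRight B≤1 cB nG′
  in ⟨ A′ ∣ B′ ⟩ , nG″ ,
     (cA′ , cB′ , AtMostOne⇒NoDominated A′≤1 , AtMostOne⇒NoDominated B′≤1 ,
      (λ a∈ r∈ r≤G″ → irrA′ a∈ r∈ (≤-trans r≤G″ G″≤G′)) , irrB′) ,
     ≈-trans (G″≤G′ , G′≤G″) G′≈G
  where
  reduceLeft : ∀ {A} → AtMostOne A → AllCanonical A → IsNumber ⟨ A ∣ B ⟩ → LeftReduct B ⟨ A ∣ B ⟩
  reduceLeft none    _        nG = [] , none , tt , nG , ≈-refl , λ ()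
  reduceLeft (one a) (ca , _) nG = reduceᴸ (⊏-wellFounded a) ca nG
  reduceRight : ∀ {B A} → AtMostOne B → AllCanonical B → IsNumber ⟨ A ∣ B ⟩ → RightReduct A ⟨ A ∣ B ⟩
  reduceRight none    _        nG = [] , none , tt , nG , ≈-refl , λ ()
  reduceRight (one b) (cb , _) nG = reduceᴿ (⊏-wellFounded b) cb nG

greatestLeft : ∀ xs → AllNumbers xs → (∀ {x} → x ∈ xs → CanonicalForm x) →
  ∃[ A ] AtMostOne A × AllCanonical A × AllNumbers A × xs ≼ A × A ≼ xs
greatestLeft []       _   _     = [] , none , tt , tt , (λ ()) , (λ ())
greatestLeft (x ∷ xs) nxs canon with maximum x xs nxs
... | m , m∈ , ≤m with canon m∈
...   | c , nc , cc , (c≤m , m≤c) =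
  c ∷ [] , one c , (cc , tt) , (nc , tt) ,
  (λ z∈ → c , here refl , ≤-trans (≤m z∈) m≤c) ,
  (λ { (here refl) → m , m∈ , c≤m ; (there ()) })

leastRight : ∀ xs → AllNumbers xs → (∀ {x} → x ∈ xs → CanonicalForm x) →
  ∃[ B ] AtMostOne B × AllCanonical B × AllNumbers B × B ≽ xs × xs ≽ B
leastRight []       _   _     = [] , none , tt , tt , (λ ()) , (λ ())
leastRight (x ∷ xs) nxs canon with minimum x xs nxs
... | m , m∈ , m≤ with canon m∈
...   | c , nc , cc , (c≤m , m≤c) =
  c ∷ [] , one c , (cc , tt) , (nc , tt) ,
  (λ { (here refl) → m , m∈ , m≤c ; (there ()) }) ,
  (λ z∈ → c , here refl , ≤-trans c≤m (m≤ z∈))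

canonicalForm′ : ∀ {x} → Acc _⊏_ x → IsNumber x → CanonicalForm x
canonicalForm′ {x@(⟨ xl ∣ xr ⟩)} (acc rs) nx@(nl , nr , _) =
  let (A , A≤1 , cA , nA , xl≼A , A≼xl) =
        greatestLeft xl nl λ p → canonicalForm′ (rs (leftOption p)) (AllNumbers-lookup nl p)
      (B , B≤1 , cB , nB , B≽xr , xr≽B) =
        leastRight xr nr λ p → canonicalForm′ (rs (rightOption p)) (AllNumbers-lookup nr p)
      y≤x = ≤-cofinal {⟨ A ∣ B ⟩} {x} A≼xl xr≽B
      x≤y = ≤-cofinal {x} {⟨ A ∣ B ⟩} xl≼A B≽xr
      ny = IsNumber-intro nA nB
             (λ a∈ → let (z , z∈ , a≤z) = A≼xl a∈ in ≤-trans a≤z (≤-trans (leftOption≤ nx z∈) x≤y))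
             (λ b∈ → let (z , z∈ , z≤b) = B≽xr b∈ in ≤-trans y≤x (≤-trans (≤rightOption nx z∈) z≤b))
      (c , nc , cc , c≈y) = reduce A≤1 cA B≤1 cB ny
  in c , nc , cc , ≈-trans c≈y (y≤x , x≤y)

canonicalForm : ∀ {x} → IsNumber x → CanonicalForm x
canonicalForm = canonicalForm′ (⊏-wellFounded _)

proposition2p8 : (G : Game) → AllNumbers (L G) → AllNumbers (R G) →
    L G ≢ [] → R G ≢ [] →
    ∃₂ λ a b → IsNumber a × IsCanonical a × IsNumber b × IsCanonical b ×
      (G ≜ ⟨ a ∷ [] ∣ b ∷ [] ⟩)
proposition2p8 ⟨ []    ∣ _ ⟩  _ _ L≢[] _ = contradiction refl L≢[]
proposition2p8 ⟨ _ ∣ [] ⟩     _ _ _ R≢[] = contradiction refl R≢[]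
proposition2p8 ⟨ x ∷ xs ∣ y ∷ ys ⟩ nL nR _ _ =
  let (m , m∈ , ≤m) = maximum x xs nL
      (a , na , ca , (a≤m , m≤a)) = canonicalForm (AllNumbers-lookup nL m∈)
      (k , k∈ , k≤) = minimum y ys nR
      (b , nb , cb , (b≤k , k≤b)) = canonicalForm (AllNumbers-lookup nR k∈)
  in a , b , na , ca , nb , cb ,
     (λ z∈ → - a , here refl , from (x-y≤0⇔x≤y _ a) (≤-trans (≤m z∈) m≤a)) ,
     (λ z∈ → - b , here refl , from (0≤x-y⇔y≤x _ b) (≤-trans b≤k (k≤ z∈))) ,
     (λ { (here refl) → k , k∈ , from (x-y≤0⇔x≤y k b) k≤b ; (there ()) }) ,
     (λ { (here refl) → m , m∈ , from (0≤x-y⇔y≤x m a) a≤m ; (there ()) })
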